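{- Let $N=(G,f)$ be a Boolean network, $(I_1,\ldots,I_k)$ an ordered partition of $V(G)$ into non-empty sets such that for all $i<j$, $G$ has no directed path from a vertex of $I_j$ to a vertex of $I_i$, and $a_1\subseteq\{0,1\}^{I_1},\ldots,a_{k-1}\subseteq\{0,1\}^{I_{k-1}}$. Let $R_1,\ldots,R_k$ and $N_1,\ldots,N_k$ be defined by $R_1=N$, $N_i=R_i[I_i]$ and $R_{i+1}=R_i(I_i,a_i)$ for $1\le i\le k-1$, and $N_k=R_k$. Then for $1\le i\le k$: $$R_i=N(I_1,a_1)\cdots(I_{i-1},a_{i-1})=N(I_1\cup\cdots\cup I_{i-1},\,a_1\times\cdots\times a_{i-1}),$$ $$N_i=N(I_1,a_1)\cdots(I_{i-1},a_{i-1})[I_i]=N[I_1\cup\cdots\cup I_i](I_1\cup\cdots\cup I_{i-1},\,a_1\times\cdots\times a_{i-1}),$$ where for $i=1$ these expressions are read as $R_1=N$ and $N_1=N[I_1]$.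
   Context: Let $\mathbb{B}=\{0,1\}$. A Boolean network is a pair $N=(G,f)$ where $G$ is a finite directed graph and $f=(f_v)_{v\in V(G)}$ with $f_v:\mathbb{B}^{G^-(v)}\to\mathbb{B}$, $G^-(v)$ the in-neighbourhood of $v$. $\mathrm{ASTG}(N)$ has vertex set $\mathbb{B}^{V(G)}$ and an edge from $x$ to $y$ iff $x,y$ differ in exactly one coordinate $v$ and $f_v(x\restriction G^-(v))=y_v\neq x_v$; networks on a given vertex set are identified with such partial orientations. For $J$ closed under in-neighbours, $N[J]=(G[J],(f_v)_{v\in J})$. For $I\subseteq V(G)$ with no edge from $V(G)\setminus I$ to $I$, $x\in\mathbb{B}^I$, $v\notin I$: $f^x_v(y)=f_v(z)$ where $z\in\mathbb{B}^{G^-(v)}$ agrees with $x$ on $G^-(v)\cap I$ and with $y$ on $G^-(v)\setminus I$; $N(I,x)=(G[V(G)\setminus I],(f^x_v)_{v\notin I})$; for $a\subseteq\mathbb{B}^I$, $N(I,a)$ is the network on $V(G)\setminus I$ whose ASTG is the edge union of the $\mathrm{ASTG}(N(I,x))$, $x\in a$. Iterated expressions like $N(I_1,a_1)(I_2,a_2)$ apply these constructions successively. -}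

module Defs where

open import Data.Bool using (Bool; if_then_else_)
open import Data.Nat using (ℕ; zero; suc)
open import Data.Fin using (Fin; zero; suc; inject₁)
open import Data.Fin.Subset using (Subset; _∈_; _∪_; _─_; ⊤)
open import Data.Fin.Subset.Properties using (_∈?_)
open import Data.Product using (Σ; ∃; _×_; _,_)
open import Data.Unit.Polymorphic using () renaming (⊤ to ⊤′)
open import Function using (_∘_; _⇔_)
open import Relation.Nullary using (¬_; does)
open import Relation.Binary.PropositionalEquality using (_≡_; _≢_)
open import Relation.Binary.Construct.Closure.ReflexiveTransitive using (Star)
open import Data.Bool using (T)

-- Vertices are Fin n.  A configuration on a vertex set S ⊆ Fin n
-- (an element of 𝔹^S) is represented by a total map Fin n → Bool whose
-- values outside S are irrelevant.

Config : ℕ → Set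
Config n = Fin n → Bool

AgreeOn : ∀ {n} → Subset n → Config n → Config n → Set
AgreeOn S x y = ∀ u → u ∈ S → x u ≡ y u

-- A Boolean network N = (G , f) on vertex set Fin n.
-- arc u v = true  iff  G has an arc u → v.
-- f_v : 𝔹^{G⁻(v)} → 𝔹 is represented by a map on full configurations that
-- depends only on the in-neighbours of v (field `local`).

record Network (n : ℕ) : Set where
  field
    arc   : Fin n → Fin n → Bool
    fun   : Fin n → Config n → Bool
    local : ∀ v x y → (∀ u → T (arc u v) → x u ≡ y u) → fun v x ≡ fun v y
open Network public

Path : ∀ {n} → Network n → Fin n → Fin n → Set
Path N = Star (λ u v → T (arc N u v))

-- Since N(I,a) is defined through the edge union of the ASTGs of the
-- N(I,x), x ∈ a, we represent a (derived) network on a vertex set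
-- V ⊆ Fin n as a family of local-function families (indexed by Idx),
-- all living on the induced subgraph G[V]; its ASTG is the edge union of
-- the ASTGs of the members.

record MNet (n : ℕ) : Set₁ where
  field
    verts : Subset n
    Idx   : Set
    funs  : Idx → Fin n → Config n → Bool
open MNet public

toM : ∀ {n} → Network n → MNet n
toM N = record { verts = ⊤ ; Idx = ⊤′ ; funs = λ _ → fun N }

Edge : ∀ {n} → MNet n → Config n → Config n → Set
Edge M x y = Σ (Idx M) λ ι → Σ _ λ v →
    v ∈ verts M
  × x v ≢ y v
  × (∀ u → u ∈ verts M → u ≢ v → x u ≡ y u)
  × funs M ι v x ≡ y v

-- Networks are identified with their ASTGs: same vertex set, same edges.
infix 4 _≈_
_≈_ : ∀ {n} → MNet n → MNet n → Set
M ≈ M' = (verts M ≡ verts M') × (∀ x y → Edge M x y ⇔ Edge M' x y)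

restrict : ∀ {n} → MNet n → Subset n → MNet n
restrict M J = record { verts = J ; Idx = Idx M ; funs = funs M }

merge : ∀ {n} → Subset n → Config n → Config n → Config n
merge I x y u = if does (u ∈? I) then x u else y u

-- A subset a ⊆ 𝔹^I is given by a predicate on configurations
-- (denoting the set of restrictions to I of the configurations satisfying it).
CPred : ℕ → Set₁
CPred n = Config n → Set

step : ∀ {n} → MNet n → Subset n → CPred n → MNet n
step {n} M I a = record
  { verts = verts M ─ I
  ; Idx   = Idx M × Σ (Config n) a
  ; funs  = λ { (ι , x , _) v y → funs M ι v (merge I x y) }
  }

Memb : ∀ {n} → Subset n → CPred n → Config n → Set
Memb I a x = ∃ λ y → a y × AgreeOn I x y

-- The sequences R_i and N_i (indices 0-based: i : Fin (suc m), k = suc m).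

Rseq : ∀ {n m} → (Fin (suc m) → Subset n) → (Fin m → CPred n) → MNet n
     → Fin (suc m) → MNet n
Rseq I a M zero = M
Rseq {m = suc m} I a M (suc i) = Rseq (I ∘ suc) (a ∘ suc) (step M (I zero) (a zero)) i

Nseq : ∀ {n m} → (Fin (suc m) → Subset n) → (Fin m → CPred n) → MNet n
     → Fin (suc m) → MNet n
Nseq {m = zero}  I a M zero = M
Nseq {m = suc m} I a M zero = restrict M (I zero)
Nseq {m = suc m} I a M (suc i) = Nseq (I ∘ suc) (a ∘ suc) (step M (I zero) (a zero)) i

-- I_1 ∪ ⋯ ∪ I_{j+1}   (inclusive, 0-based j)
UnionUpTo : ∀ {n m} → (Fin m → Subset n) → Fin m → Subset n
UnionUpTo I zero = I zero
UnionUpTo I (suc j) = I zero ∪ UnionUpTo (I ∘ suc) j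

ProdUpTo : ∀ {n m} → (Fin m → Subset n) → (Fin m → CPred n) → Fin m → CPred n
ProdUpTo I a zero x = Memb (I zero) (a zero) x
ProdUpTo I a (suc j) x = Memb (I zero) (a zero) x × ProdUpTo (I ∘ suc) (a ∘ suc) j x

closedR : ∀ {n m} → Network n → (Fin (suc m) → Subset n) → (Fin m → CPred n)
        → Fin (suc m) → MNet n
closedR N I a zero = toM N
closedR N I a (suc j) =
  step (toM N) (UnionUpTo (I ∘ inject₁) j) (ProdUpTo (I ∘ inject₁) a j)

closedN : ∀ {n m} → Network n → (Fin (suc m) → Subset n) → (Fin m → CPred n)
        → Fin (suc m) → MNet n
closedN N I a zero = restrict (toM N) (I zero)
closedN N I a (suc j) =
  step (restrict (toM N) (UnionUpTo I (suc j)))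
       (UnionUpTo (I ∘ inject₁) j) (ProdUpTo (I ∘ inject₁) a j)

-- All equalities are proved for the families of local functions, which determine
-- the ASTGs.  Both closed forms rest on two laws of N(I,a), valid whenever the local
-- functions are extensional:
--   N(I,a) = N(I, a')                       where a' is the set of x with x↾I ∈ a,
--   N(I,a)(J,b) = N(I ∪ J, a × b)           for I, J disjoint and b depending only on J.
-- Iterating the second law along the partition gives the closed form of R_i.
-- For N_i, removing I_1, …, I_{i-1} from V(G) leaves exactly I_i ∪ ⋯ ∪ I_k, so
-- N_i and R_i[I_i] have the same vertex set; and R_i[I_i] is N(I_1 ∪ ⋯ ∪ I_{i-1}, …)
-- restricted to (I_1 ∪ ⋯ ∪ I_i) ∖ (I_1 ∪ ⋯ ∪ I_{i-1}) = I_i, which is the second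
-- closed form.
module Submission where

open import Defs
open import Data.Empty using (⊥-elim)
open import Data.Fin using (Fin; zero; suc; inject₁; _≤_; _<_)
open import Data.Fin.Properties using (suc-injective; ≤̄⇒inject₁<; <-irrefl)
open import Data.Fin.Subset using (Subset; _∈_; _∉_; _⊆_; Nonempty; _∪_; _─_; inside; outside)
open import Data.Fin.Subset.Properties
  using (_∈?_; x∈p∪q⁻; x∈p∪q⁺; ⊆-antisym; ∈⊤; ∪-assoc; p─q⊆p; p─q─r≡p─q∪r; x∈p∧x∉q⇒x∈p─q)
open import Data.Nat using (ℕ; suc; z≤n; s≤s)
open import Data.Product using (∃; _×_; _,_; proj₁; proj₂)
open import Data.Sum using (inj₁; inj₂)
open import Data.Vec using (_∷_; here; there)
open import Function using (_∘_; mk⇔)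
open import Relation.Nullary using (¬_; yes; no)
open import Relation.Binary.PropositionalEquality
  using (_≡_; _≢_; refl; sym; trans; cong; subst; module ≡-Reasoning)

private
  variable
    n m : ℕ

x∈p─q⇒x∉q : ∀ (p q : Subset n) {x} → x ∈ p ─ q → x ∉ q
x∈p─q⇒x∉q (inside  ∷ p) (outside ∷ q) here      ()
x∈p─q⇒x∉q (s       ∷ p) (t       ∷ q) (there h) (there h′) = x∈p─q⇒x∉q p q h h′

x∈p∪q─p⇒x∈q : ∀ (p q : Subset n) {x} → x ∈ (p ∪ q) ─ p → x ∈ q
x∈p∪q─p⇒x∈q p q x∈p∪q─p with x∈p∪q⁻ p q (p─q⊆p (p ∪ q) p x∈p∪q─p)
... | inj₁ x∈p = ⊥-elim (x∈p─q⇒x∉q (p ∪ q) p x∈p∪q─p x∈p)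
... | inj₂ x∈q = x∈q

q≡p∪q─p : ∀ (p q : Subset n) → (∀ {x} → x ∈ p → x ∉ q) → q ≡ (p ∪ q) ─ p
q≡p∪q─p p q p∩q≡∅ = ⊆-antisym
  (λ x∈q → x∈p∧x∉q⇒x∈p─q (x∈p∪q⁺ (inj₂ x∈q)) (λ x∈p → p∩q≡∅ x∈p x∈q))
  (x∈p∪q─p⇒x∈q p q)

module _ {I : Subset n} (x y : Config n) {u : Fin n} where

  merge-∈ : u ∈ I → merge I x y u ≡ x u
  merge-∈ u∈I with u ∈? I
  ... | yes _   = refl
  ... | no u∉I = ⊥-elim (u∉I u∈I)

  merge-∉ : u ∉ I → merge I x y u ≡ y u
  merge-∉ u∉I with u ∈? I
  ... | yes u∈I = ⊥-elim (u∉I u∈I)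
  ... | no _    = refl

merge-cong : ∀ (I : Subset n) {x x′ y y′ : Config n} →
             AgreeOn I x x′ → (∀ u → u ∉ I → y u ≡ y′ u) →
             ∀ u → merge I x y u ≡ merge I x′ y′ u
merge-cong I x≈x′ y≈y′ u with u ∈? I
... | yes u∈I = x≈x′ u u∈I
... | no  u∉I = y≈y′ u u∉I

merge-∪ : ∀ (I J : Subset n) {x y z w : Config n} →
          AgreeOn I x z → AgreeOn J y z →
          ∀ u → merge I x (merge J y w) u ≡ merge (I ∪ J) z w u
merge-∪ I J {x} {y} {z} {w} x≈z y≈z u with u ∈? I | u ∈? J
... | yes u∈I | _       = trans (x≈z u u∈I) (sym (merge-∈ z w (x∈p∪q⁺ (inj₁ u∈I))))
... | no _    | yes u∈J = trans (y≈z u u∈J) (sym (merge-∈ z w (x∈p∪q⁺ (inj₂ u∈J))))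
... | no u∉I | no u∉J = sym (merge-∉ z w u∉I∪J)
  where
  u∉I∪J : u ∉ I ∪ J
  u∉I∪J u∈I∪J with x∈p∪q⁻ I J u∈I∪J
  ... | inj₁ u∈I = u∉I u∈I
  ... | inj₂ u∈J = u∉J u∈J

infix 4 _≼_ _≃_
_≼_ : MNet n → MNet n → Set
M ≼ M′ = ∀ ι → ∃ λ ι′ → ∀ v x → funs M ι v x ≡ funs M′ ι′ v x

_≃_ : MNet n → MNet n → Set
M ≃ M′ = (verts M ≡ verts M′) × M ≼ M′ × M′ ≼ M

≼-refl : ∀ (M : MNet n) → M ≼ M
≼-refl M ι = ι , λ _ _ → refl

≼-trans : ∀ {A B C : MNet n} → A ≼ B → B ≼ C → A ≼ C
≼-trans A≼B B≼C ι with A≼B ι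
... | ι′ , fι≡fι′ with B≼C ι′
... | ι″ , fι′≡fι″ = ι″ , λ v x → trans (fι≡fι′ v x) (fι′≡fι″ v x)

≃-refl : ∀ (M : MNet n) → M ≃ M
≃-refl M = refl , ≼-refl M , ≼-refl M

≃-trans : ∀ {A B C : MNet n} → A ≃ B → B ≃ C → A ≃ C
≃-trans {A = A} {B} {C} (V≡ , A≼B , B≼A) (V≡′ , B≼C , C≼B) =
  trans V≡ V≡′ , ≼-trans {A = A} {B} {C} A≼B B≼C , ≼-trans {A = C} {B} {A} C≼B B≼A

≼-Edge : ∀ {M M′ : MNet n} → verts M ≡ verts M′ → M ≼ M′ →
         ∀ {x y} → Edge M x y → Edge M′ x y
≼-Edge V≡ M≼M′ {x} (ι , v , v∈V , xv≢yv , agree , fv≡yv) =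
  proj₁ (M≼M′ ι) , v , subst (v ∈_) V≡ v∈V , xv≢yv ,
  (λ u u∈V′ → agree u (subst (u ∈_) (sym V≡) u∈V′)) ,
  trans (sym (proj₂ (M≼M′ ι) v x)) fv≡yv

≃⇒≈ : ∀ {M M′ : MNet n} → M ≃ M′ → M ≈ M′
≃⇒≈ (V≡ , M≼M′ , M′≼M) = V≡ , λ _ _ → mk⇔ (≼-Edge V≡ M≼M′) (≼-Edge (sym V≡) M′≼M)

restrict-cong : ∀ {M M′ : MNet n} {J J′ : Subset n} →
                M ≃ M′ → J ≡ J′ → restrict M J ≃ restrict M′ J′
restrict-cong (_ , M≼M′ , M′≼M) J≡J′ = J≡J′ , M≼M′ , M′≼M

Extensional : MNet n → Set
Extensional M = ∀ ι v {x y} → (∀ u → x u ≡ y u) → funs M ι v x ≡ funs M ι v y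

toM-extensional : ∀ (N : Network n) → Extensional (toM N)
toM-extensional N _ v x≗y = local N v _ _ (λ u _ → x≗y u)

step-extensional : ∀ {M : MNet n} (I : Subset n) (a : CPred n) → Extensional M → Extensional (step M I a)
step-extensional I a ext (ι , x , _) v y≗y′ =
  ext ι v (merge-cong I (λ _ _ → refl) (λ u _ → y≗y′ u))

DependsOnlyOn : CPred n → Subset n → Set
DependsOnlyOn b J = ∀ {x y} → AgreeOn J x y → b x → b y

Memb-dependsOnlyOn : ∀ (I : Subset n) (a : CPred n) → DependsOnlyOn (Memb I a) I
Memb-dependsOnlyOn I a x≈y (z , z∈a , x≈z) =
  z , z∈a , λ u u∈I → trans (sym (x≈y u u∈I)) (x≈z u u∈I)

ProdUpTo-dependsOnlyOn : ∀ (I : Fin m → Subset n) (a : Fin m → CPred n) j →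
                         DependsOnlyOn (ProdUpTo I a j) (UnionUpTo I j)
ProdUpTo-dependsOnlyOn I a zero = Memb-dependsOnlyOn (I zero) (a zero)
ProdUpTo-dependsOnlyOn I a (suc j) x≈y (x∈a₀ , x∈as) =
  Memb-dependsOnlyOn (I zero) (a zero) (λ u u∈I → x≈y u (x∈p∪q⁺ (inj₁ u∈I))) x∈a₀ ,
  ProdUpTo-dependsOnlyOn (I ∘ suc) (a ∘ suc) j (λ u u∈U → x≈y u (x∈p∪q⁺ (inj₂ u∈U))) x∈as

module _ {M : MNet n} (ext : Extensional M) where

  step-Memb : ∀ (I : Subset n) (a : CPred n) → step M I a ≃ step M I (Memb I a)
  step-Memb I a = refl , to , from
    where
    to : step M I a ≼ step M I (Memb I a)
    to (ι , x , x∈a) = (ι , x , x , x∈a , λ _ _ → refl) , λ _ _ → refl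
    from : step M I (Memb I a) ≼ step M I a
    from (ι , x , z , z∈a , x≈z) =
      (ι , z , z∈a) , λ v y → ext ι v (merge-cong I x≈z (λ _ _ → refl))

  step-step : ∀ (I J : Subset n) (a b : CPred n) → (∀ {u} → u ∈ I → u ∉ J) → DependsOnlyOn b J →
              step (step M I a) J b ≃ step M (I ∪ J) (λ x → Memb I a x × b x)
  step-step I J a b I∩J≡∅ b-on-J = p─q─r≡p─q∪r (verts M) I J , to , from
    where
    to : step (step M I a) J b ≼ step M (I ∪ J) (λ x → Memb I a x × b x)
    to ((ι , x , x∈a) , y , y∈b) =
      (ι , merge I x y , (x , x∈a , λ u u∈I → merge-∈ x y u∈I) ,
        b-on-J (λ u u∈J → sym (merge-∉ x y (λ u∈I → I∩J≡∅ u∈I u∈J))) y∈b) ,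
      λ v z → ext ι v (merge-∪ I J (λ u u∈I → sym (merge-∈ x y u∈I))
                                   (λ u u∈J → sym (merge-∉ x y (λ u∈I → I∩J≡∅ u∈I u∈J))))
    from : step M (I ∪ J) (λ x → Memb I a x × b x) ≼ step (step M I a) J b
    from (ι , x , (x₀ , x₀∈a , x≈x₀) , x∈b) =
      ((ι , x₀ , x₀∈a) , x , x∈b) ,
      λ v z → sym (ext ι v (merge-∪ I J (λ u u∈I → sym (x≈x₀ u u∈I)) (λ _ _ → refl)))

Disjoint : (Fin m → Subset n) → Set
Disjoint I = ∀ i j u → u ∈ I i → u ∈ I j → i ≡ j

Disjoint-suc : ∀ {I : Fin (suc m) → Subset n} → Disjoint I → Disjoint (I ∘ suc)
Disjoint-suc disj i j u u∈Iᵢ u∈Iⱼ = suc-injective (disj (suc i) (suc j) u u∈Iᵢ u∈Iⱼ)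

Covers : (Fin m → Subset n) → Subset n → Set
Covers I V = (∀ {u} → u ∈ V → ∃ λ i → u ∈ I i) × (∀ i → I i ⊆ V)

Covers-suc : ∀ {I : Fin (suc m) → Subset n} {V : Subset n} →
             Disjoint I → Covers I V → Covers (I ∘ suc) (V ─ I zero)
Covers-suc {I = I} {V} disj (V⊆⋃I , I⊆V) = V─I₀⊆⋃I , I₊⊆V─I₀
  where
  V─I₀⊆⋃I : ∀ {u} → u ∈ V ─ I zero → ∃ λ i → u ∈ I (suc i)
  V─I₀⊆⋃I u∈V─I₀ with V⊆⋃I (p─q⊆p V (I zero) u∈V─I₀)
  ... | zero  , u∈I₀ = ⊥-elim (x∈p─q⇒x∉q V (I zero) u∈V─I₀ u∈I₀)
  ... | suc i , u∈Iᵢ = i , u∈Iᵢ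
  I₊⊆V─I₀ : ∀ i → I (suc i) ⊆ V ─ I zero
  I₊⊆V─I₀ i {u} u∈Iᵢ =
    x∈p∧x∉q⇒x∈p─q (I⊆V (suc i) u∈Iᵢ) λ u∈I₀ → zero≢suc (disj zero (suc i) u u∈I₀ u∈Iᵢ)
    where
    zero≢suc : ∀ {k} {j : Fin k} → zero ≢ suc j
    zero≢suc ()

∈-UnionUpTo⁻ : ∀ (I : Fin m → Subset n) j {u} →
               u ∈ UnionUpTo I j → ∃ λ k → k ≤ j × u ∈ I k
∈-UnionUpTo⁻ I zero    u∈I₀ = zero , z≤n , u∈I₀
∈-UnionUpTo⁻ I (suc j) u∈U with x∈p∪q⁻ (I zero) _ u∈U
... | inj₁ u∈I₀ = zero , z≤n , u∈I₀
... | inj₂ u∈U′ with ∈-UnionUpTo⁻ (I ∘ suc) j u∈U′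
... | k , k≤j , u∈Iₖ = suc k , s≤s k≤j , u∈Iₖ

UnionUpTo-suc : ∀ (I : Fin (suc m) → Subset n) j →
                UnionUpTo I (suc j) ≡ UnionUpTo (I ∘ inject₁) j ∪ I (suc j)
UnionUpTo-suc I zero = refl
UnionUpTo-suc {m = suc m} I (suc j) = begin
  I zero ∪ UnionUpTo (I ∘ suc) (suc j)
    ≡⟨ cong (I zero ∪_) (UnionUpTo-suc (I ∘ suc) j) ⟩
  I zero ∪ (UnionUpTo (I ∘ suc ∘ inject₁) j ∪ I (suc (suc j)))
    ≡⟨ ∪-assoc (I zero) _ _ ⟨
  UnionUpTo (I ∘ inject₁) (suc j) ∪ I (suc (suc j))
    ∎
  where open ≡-Reasoning

I-suc≡UnionUpTo─UnionUpTo : ∀ {I : Fin (suc m) → Subset n} → Disjoint I →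
  ∀ j → I (suc j) ≡ UnionUpTo I (suc j) ─ UnionUpTo (I ∘ inject₁) j
I-suc≡UnionUpTo─UnionUpTo {I = I} disj j = begin
  I (suc j)                 ≡⟨ q≡p∪q─p U (I (suc j)) U∩Iⱼ≡∅ ⟩
  (U ∪ I (suc j)) ─ U       ≡⟨ cong (_─ U) (UnionUpTo-suc I j) ⟨
  UnionUpTo I (suc j) ─ U   ∎
  where
  open ≡-Reasoning
  U : Subset _
  U = UnionUpTo (I ∘ inject₁) j
  U∩Iⱼ≡∅ : ∀ {u} → u ∈ U → u ∉ I (suc j)
  U∩Iⱼ≡∅ u∈U u∈Iⱼ with ∈-UnionUpTo⁻ (I ∘ inject₁) j u∈U
  ... | k , k≤j , u∈Iₖ = <-irrefl (disj _ _ _ u∈Iₖ u∈Iⱼ) (≤̄⇒inject₁< k≤j)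

Rseq≃step : ∀ (I : Fin (suc m) → Subset n) (a : Fin m → CPred n) {M : MNet n} →
  Extensional M → Disjoint I →
  ∀ j → Rseq I a M (suc j) ≃ step M (UnionUpTo (I ∘ inject₁) j) (ProdUpTo (I ∘ inject₁) a j)
Rseq≃step {m = suc m} I a ext disj zero = step-Memb ext (I zero) (a zero)
Rseq≃step {m = suc m} I a {M} ext disj (suc j) = ≃-trans
  (Rseq≃step (I ∘ suc) (a ∘ suc) (step-extensional {M = M} (I zero) (a zero) ext)
             (Disjoint-suc disj) j)
  (step-step ext (I zero) _ (a zero) _ I₀∩later≡∅
             (ProdUpTo-dependsOnlyOn (I ∘ suc ∘ inject₁) (a ∘ suc) j))
  where
  I₀∩later≡∅ : ∀ {u} → u ∈ I zero → u ∉ UnionUpTo (I ∘ suc ∘ inject₁) j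
  I₀∩later≡∅ u∈I₀ u∈U with ∈-UnionUpTo⁻ (I ∘ suc ∘ inject₁) j u∈U
  ... | k , _ , u∈Iₖ with disj zero (suc (inject₁ k)) _ u∈I₀ u∈Iₖ
  ... | ()

Nseq≃restrict-Rseq : ∀ (I : Fin (suc m) → Subset n) (a : Fin m → CPred n) (M : MNet n) →
  Disjoint I → Covers I (verts M) → ∀ i → Nseq I a M i ≃ restrict (Rseq I a M i) (I i)
Nseq≃restrict-Rseq {m = 0} I a M disj (V⊆⋃I , I⊆V) zero =
  ⊆-antisym V⊆I₀ (I⊆V zero) , ≼-refl M , ≼-refl M
  where
  V⊆I₀ : verts M ⊆ I zero
  V⊆I₀ u∈V with V⊆⋃I u∈V
  ... | zero , u∈I₀ = u∈I₀
Nseq≃restrict-Rseq {m = suc m} I a M disj cover zero    = ≃-refl _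
Nseq≃restrict-Rseq {m = suc m} I a M disj cover (suc i) =
  Nseq≃restrict-Rseq (I ∘ suc) (a ∘ suc) (step M (I zero) (a zero))
                     (Disjoint-suc disj) (Covers-suc disj cover) i

module _ (N : Network n) (I : Fin (suc m) → Subset n) (a : Fin m → CPred n)
         (disj : Disjoint I) where

  Rseq≃closedR : ∀ i → Rseq I a (toM N) i ≃ closedR N I a i
  Rseq≃closedR zero    = ≃-refl _
  Rseq≃closedR (suc j) = Rseq≃step I a (toM-extensional N) disj j

  -- closedN N I a (suc j) is, definitionally, closedR N I a (suc j) restricted to
  -- (I_1 ∪ ⋯ ∪ I_{j+2}) ∖ (I_1 ∪ ⋯ ∪ I_{j+1})
  restrict-Rseq≃closedN : ∀ i → restrict (Rseq I a (toM N) i) (I i) ≃ closedN N I a i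
  restrict-Rseq≃closedN zero    = ≃-refl _
  restrict-Rseq≃closedN (suc j) =
    restrict-cong (Rseq≃closedR (suc j)) (I-suc≡UnionUpTo─UnionUpTo disj j)

corollary7 : ∀ {n m} (N : Network n) (I : Fin (suc m) → Subset n) (a : Fin m → CPred n)
    → (∀ i → Nonempty (I i))
    → (∀ i j u → u ∈ I i → u ∈ I j → i ≡ j)
    → (∀ u → ∃ λ i → u ∈ I i)
    → (∀ i j → i < j → ∀ u v → u ∈ I j → v ∈ I i → ¬ Path N u v)
    → ∀ i →
    (Rseq I a (toM N) i ≈ closedR N I a i)
    × (Nseq I a (toM N) i ≈ restrict (Rseq I a (toM N) i) (I i))
    × (Nseq I a (toM N) i ≈ closedN N I a i)
corollary7 N I a _ disj cover _ i =
  ≃⇒≈ (Rseq≃closedR N I a disj i) ,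
  ≃⇒≈ Nᵢ≃restrict-Rᵢ ,
  ≃⇒≈ (≃-trans Nᵢ≃restrict-Rᵢ (restrict-Rseq≃closedN N I a disj i))
  where
  Nᵢ≃restrict-Rᵢ : Nseq I a (toM N) i ≃ restrict (Rseq I a (toM N) i) (I i)
  Nᵢ≃restrict-Rᵢ =
    Nseq≃restrict-Rseq I a (toM N) disj ((λ {u} _ → cover u) , (λ _ _ → ∈⊤)) i
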